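{- In the setting of the context, the map $\varphi:A/\theta_{\mathcal F}\to\mathsf{Up}(\langle E_Y,\preceq_Y\rangle)$, $\varphi([a])=R_{[a]}$, is a well-defined injective function.
   Context: Let $I$ be an index set, $\mathcal F$ an ultrafilter on $I$. For each $i\in I$ let $\langle X_i,\le_i\rangle$ be a nonempty poset, $E_i$ an equivalence relation on $X_i$ with ${\le_i}\subseteq E_i$, $\alpha_i$ an order automorphism with $\alpha_i\subseteq E_i$; order $E_i$ by $(u,v)\preceq_i(x,y)$ iff $x\le_i u$ and $v\le_i y$. Let $\mathbf A_i$ be a distributive involutive FL-algebra and $\varphi_i$ an embedding (injective homomorphism) of $\mathbf A_i$ into the algebra of upsets of $\langle E_i,\preceq_i\rangle$. Let $\mathbf A=\prod_i\mathbf A_i$ and $\theta_{\mathcal F}$ the congruence $(a,b)\in\theta_{\mathcal F}$ iff $\{i\mid a(i)=b(i)\}\in\mathcal F$. Let $X=\prod_iX_i$, $Y=X/E_{\mathcal F}$ where $(x,y)\in E_{\mathcal F}$ iff $\{i\mid x(i)=y(i)\}\in\mathcal F$; $[x]\le_Y[y]$ iff $\{i\mid x(i)\le_iy(i)\}\in\mathcal F$; $([x],[y])\in E_Y$ iff $\{i\mid(x(i),y(i))\in E_i\}\in\mathcal F$; $([u],[v])\preceq_Y([x],[y])$ iff $[x]\le_Y[u]$ and $[v]\le_Y[y]$; $\mathsf{Up}$ denotes the set of upsets. For $[a]\in A/\theta_{\mathcal F}$ define $([x],[y])\in R_{[a]}$ iff $\{i\in I\mid (x(i),y(i))\in\varphi_i(a(i))\}\in\mathcal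 F$. -}

module Defs where

open import Level using (0ℓ)
open import Data.Product using (_×_; _,_; Σ)
open import Data.Sum using (_⊎_)
open import Data.Unit using (⊤)
open import Data.Empty using (⊥)
open import Relation.Nullary using (¬_)
open import Relation.Unary using (Pred; _⊆_; _∩_; ∁)
open import Relation.Binary using (Rel; IsPartialOrder; IsEquivalence)
open import Relation.Binary.PropositionalEquality using (_≡_)
open import Function.Bundles using (_⇔_)
open import Function.Definitions using (Bijective)

record Ultrafilter (I : Set) : Set₁ where
  field
    F        : Pred I 0ℓ → Set
    full     : F (λ _ → ⊤)
    proper   : ¬ F (λ _ → ⊥)
    upward   : ∀ {S T : Pred I 0ℓ} → S ⊆ T → F S → F T
    ∩-closed : ∀ {S T : Pred I 0ℓ} → F S → F T → F (S ∩ T)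
    ultra    : ∀ (S : Pred I 0ℓ) → F S ⊎ F (∁ S)

_≼⟨_⟩_ : {X : Set} → (X × X) → Rel X 0ℓ → (X × X) → Set
(u , v) ≼⟨ _≤_ ⟩ (x , y) = (x ≤ u) × (v ≤ y)

IsUpset : {X : Set} → (E : Rel X 0ℓ) → (_≤_ : Rel X 0ℓ) → (U : Rel X 0ℓ) → Set
IsUpset {X} E _≤_ U =
  (∀ {x y : X} → U x y → E x y) ×
  (∀ {u v x y : X} → U u v → (u , v) ≼⟨ _≤_ ⟩ (x , y) → E x y → U x y)

record Component : Set₁ where
  field
    X          : Set
    _≤_        : Rel X 0ℓ
    isPO       : IsPartialOrder _≡_ _≤_
    point      : X
    E          : Rel X 0ℓ
    isEquivE   : IsEquivalence E
    ≤⊆E        : ∀ {x y} → x ≤ y → E x y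
    α          : X → X
    α-bij      : Bijective _≡_ _≡_ α
    α-order    : ∀ x y → (x ≤ y) ⇔ (α x ≤ α y)
    α⊆E        : ∀ x → E x (α x)
    A          : Set
    φ          : A → Rel X 0ℓ
    φ-upset    : ∀ a → IsUpset E _≤_ (φ a)
    φ-injective : ∀ a b → (∀ x y → φ a x y ⇔ φ b x y) → a ≡ b

module Construction {I : Set} (𝓕 : Ultrafilter I) (C : I → Component) where
  open Ultrafilter 𝓕 using (F)

  Xπ : Set
  Xπ = (i : I) → Component.X (C i)

  Aπ : Set
  Aπ = (i : I) → Component.A (C i)

  -- E_𝓕 : Y = X / E_𝓕
  _E𝓕_ : Rel Xπ 0ℓ
  x E𝓕 y = F (λ i → x i ≡ y i)

  θ𝓕 : Rel Aπ 0ℓ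
  θ𝓕 a b = F (λ i → a i ≡ b i)

  -- ≤_Y and E_Y, on representatives
  _≤Y_ : Rel Xπ 0ℓ
  x ≤Y y = F (λ i → Component._≤_ (C i) (x i) (y i))

  EY : Rel Xπ 0ℓ
  EY x y = F (λ i → Component.E (C i) (x i) (y i))

  R : Aπ → Rel Xπ 0ℓ
  R a x y = F (λ i → Component.φ (C i) (a i) (x i) (y i))

{-# OPTIONS --safe #-}
module Submission where

open import Defs
open import Level using (0ℓ)
open import Data.Product using (_×_; _,_; Σ; ∃; proj₁; proj₂)
open import Data.Sum using (_⊎_; inj₁; inj₂)
open import Data.Empty using (⊥-elim)
open import Relation.Nullary using (¬_; yes; no)
open import Relation.Unary using (Pred; _∪_; ∁)
open import Relation.Binary using (Rel)
open import Relation.Binary.PropositionalEquality using (_≢_; subst; subst₂; sym)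
open import Function.Bundles using (_⇔_; mk⇔; Equivalence)
open import Function.Properties.Equivalence using () renaming (sym to ⇔-sym)
open import Axiom.ExcludedMiddle using (ExcludedMiddle)
open import Axiom.DoubleNegationElimination using (em⇒dne)

-- Every property of [a], [x], [y] involved holds iff it holds index-wise on a set in 𝓕, and 𝓕
-- is closed under finite intersections and supersets, so well-definedness and the upset
-- property transfer from the components. For injectivity, if a and b differ on a set in 𝓕, then φ_i(a i) ≠ φ_i(b i) there, so each such
-- index has a pair in the difference of the two upsets; as 𝓕 is an ultrafilter, one direction
-- of difference, say φ_i(a i) ∖ φ_i(b i), occurs on a set in 𝓕, and choosing a separating pair
-- at every index of it yields ([x],[y]) ∈ R_[a] ∖ R_[b].

Separates : {X : Set} → Rel X 0ℓ → Rel X 0ℓ → Pred (X × X) 0ℓ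
Separates P Q (x , y) = P x y × ¬ Q x y

¬⇔⇒separated : ExcludedMiddle 0ℓ → {X : Set} {P Q : Rel X 0ℓ} →
               ¬ (∀ x y → P x y ⇔ Q x y) →
               ∃ (Separates P Q) ⊎ ∃ (Separates Q P)
¬⇔⇒separated em {P = P} {Q} ¬P⇔Q with em {∃ (Separates P Q)} | em {∃ (Separates Q P)}
... | yes P∖Q  | _        = inj₁ P∖Q
... | no  _    | yes Q∖P  = inj₂ Q∖P
... | no  ¬P∖Q | no  ¬Q∖P = ⊥-elim (¬P⇔Q λ x y →
  mk⇔ (λ p → em⇒dne em λ ¬q → ¬P∖Q ((x , y) , p , ¬q))
      (λ q → em⇒dne em λ ¬p → ¬Q∖P ((x , y) , q , ¬p)))

separated⇒¬⇔ : {X : Set} {P Q : Rel X 0ℓ} → ∃ (Separates P Q) → ¬ (∀ x y → P x y ⇔ Q x y)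
separated⇒¬⇔ ((x , y) , p , ¬q) P⇔Q = ¬q (Equivalence.to (P⇔Q x y) p)

ε-choice : ExcludedMiddle 0ℓ → {I : Set} {B : I → Set} (P : (i : I) → Pred (B i) 0ℓ) →
           (∀ i → B i) → Σ (∀ i → B i) λ f → ∀ i → Σ (B i) (P i) → P i (f i)
ε-choice em {B = B} P default = choose , chosen
  where
  choose : ∀ i → B i
  choose i with em {Σ (B i) (P i)}
  ... | yes (b , _) = b
  ... | no  _       = default i

  chosen : ∀ i → Σ (B i) (P i) → P i (choose i)
  chosen i b with em {Σ (B i) (P i)}
  ... | yes (_ , p) = p
  ... | no  ¬b      = ⊥-elim (¬b b)

module UltrafilterProperties {I : Set} (𝓕 : Ultrafilter I) where
  open Ultrafilter 𝓕

  F-map₂ : {S T U : Pred I 0ℓ} → (∀ {i} → S i → T i → U i) → F S → F T → F U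
  F-map₂ f FS FT = upward (λ (s , t) → f s t) (∩-closed FS FT)

  F⇒¬F∁ : {S : Pred I 0ℓ} → F S → ¬ F (∁ S)
  F⇒¬F∁ FS F∁S = proper (F-map₂ (λ s ¬s → ¬s s) FS F∁S)

  ¬F⇒F∁ : {S : Pred I 0ℓ} → ¬ F S → F (∁ S)
  ¬F⇒F∁ {S} ¬FS with ultra S
  ... | inj₁ FS  = ⊥-elim (¬FS FS)
  ... | inj₂ F∁S = F∁S

  F-∪ : {S T : Pred I 0ℓ} → F (S ∪ T) → F S ⊎ F T
  F-∪ {S} {T} FS∪T with ultra S | ultra T
  ... | inj₁ FS  | _        = inj₁ FS
  ... | inj₂ _   | inj₁ FT  = inj₂ FT
  ... | inj₂ F∁S | inj₂ F∁T =
    ⊥-elim (F⇒¬F∁ FS∪T (F-map₂ (λ ¬s ¬t → λ { (inj₁ s) → ¬s s ; (inj₂ t) → ¬t t }) F∁S F∁T))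

module UltraproductRelations {I : Set} (𝓕 : Ultrafilter I) (C : I → Component) where
  open Construction 𝓕 C
  open Ultrafilter 𝓕
  open UltrafilterProperties 𝓕
  module Cᵢ (i : I) = Component (C i)

  R-respects-θ𝓕 : ∀ {a b} → θ𝓕 a b → ∀ {x y} → R a x y → R b x y
  R-respects-θ𝓕 a≈b = F-map₂ (λ aᵢ≡bᵢ r → subst (λ c → Cᵢ.φ _ c _ _) aᵢ≡bᵢ r) a≈b

  R-respects-E𝓕 : ∀ {a x x′ y y′} → x E𝓕 x′ → y E𝓕 y′ → R a x y → R a x′ y′
  R-respects-E𝓕 x≈x′ y≈y′ =
    F-map₂ (λ (xᵢ≡x′ᵢ , yᵢ≡y′ᵢ) r → subst₂ (Cᵢ.φ _ _) xᵢ≡x′ᵢ yᵢ≡y′ᵢ r) (∩-closed x≈x′ y≈y′)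

  R-upset : ∀ a → IsUpset EY _≤Y_ (R a)
  R-upset a = R⊆EY , R-up
    where
    R⊆EY : ∀ {x y} → R a x y → EY x y
    R⊆EY = upward λ {i} → proj₁ (Cᵢ.φ-upset i (a i))

    R-up : ∀ {u v x y} → R a u v → (u , v) ≼⟨ _≤Y_ ⟩ (x , y) → EY x y → R a x y
    R-up r (x≤u , v≤y) e =
      F-map₂ (λ {i} (rᵢ , x≤uᵢ) (v≤yᵢ , eᵢ) → proj₂ (Cᵢ.φ-upset i (a i)) rᵢ (x≤uᵢ , v≤yᵢ) eᵢ)
             (∩-closed r x≤u) (∩-closed v≤y e)

  Separated : Aπ → Aπ → Pred I 0ℓ
  Separated a b i = ∃ (Separates (Cᵢ.φ i (a i)) (Cᵢ.φ i (b i)))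

  module _ (em : ExcludedMiddle 0ℓ) where

    F-Separated⇒R-separated : ∀ {a b} → F (Separated a b) → ∃ (Separates (R a) (R b))
    F-Separated⇒R-separated {a} {b} F-sep = (x , y) , Raxy , ¬Rbxy
      where
      open Σ (ε-choice em (λ i → Separates (Cᵢ.φ i (a i)) (Cᵢ.φ i (b i)))
                        (λ i → Cᵢ.point i , Cᵢ.point i))
        renaming (proj₁ to pick; proj₂ to pick-separates)
      x y : Xπ
      x i = proj₁ (pick i)
      y i = proj₂ (pick i)

      Raxy : R a x y
      Raxy = upward (λ {i} s → proj₁ (pick-separates i s)) F-sep

      ¬Rbxy : ¬ R b x y
      ¬Rbxy Rbxy = proper (F-map₂ (λ {i} s rᵢ → proj₂ (pick-separates i s) rᵢ) F-sep Rbxy)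

    ≢⇒Separated : ∀ {a b i} → a i ≢ b i → (Separated a b ∪ Separated b a) i
    ≢⇒Separated {i = i} aᵢ≢bᵢ =
      ¬⇔⇒separated em (λ φa⇔φb → aᵢ≢bᵢ (Cᵢ.φ-injective i _ _ φa⇔φb))

    R-injective : ∀ {a b} → (∀ x y → R a x y ⇔ R b x y) → θ𝓕 a b
    R-injective {a} {b} Ra⇔Rb with em {θ𝓕 a b}
    ... | yes a≈b = a≈b
    ... | no  a≉b with F-∪ (upward (≢⇒Separated {a} {b}) (¬F⇒F∁ a≉b))
    ...   | inj₁ F-ab = ⊥-elim (separated⇒¬⇔ (F-Separated⇒R-separated F-ab) Ra⇔Rb)
    ...   | inj₂ F-ba =
      ⊥-elim (separated⇒¬⇔ (F-Separated⇒R-separated F-ba) (λ x y → ⇔-sym (Ra⇔Rb x y)))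

lemma4p8 : ExcludedMiddle 0ℓ →
    (I : Set) (𝓕 : Ultrafilter I) (C : I → Component) →
    let open Construction 𝓕 C in
    -- well-defined: independent of the representative of [a]
    (∀ a b → θ𝓕 a b → ∀ x y → R a x y ⇔ R b x y) ×
    -- well-defined: R_[a] is a relation on Y = X / E_𝓕
    (∀ a x x′ y y′ → x E𝓕 x′ → y E𝓕 y′ → R a x y → R a x′ y′) ×
    -- R_[a] ∈ Up(⟨E_Y, ≼_Y⟩)
    (∀ a → IsUpset EY _≤Y_ (R a)) ×
    -- injective
    (∀ a b → (∀ x y → R a x y ⇔ R b x y) → θ𝓕 a b)
lemma4p8 em I 𝓕 C =
    (λ a b a≈b x y → mk⇔ (R-respects-θ𝓕 a≈b) (R-respects-θ𝓕 (upward sym a≈b)))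
  , (λ a x x′ y y′ → R-respects-E𝓕)
  , R-upset
  , (λ a b → R-injective em)
  where
  open UltraproductRelations 𝓕 C
  open Ultrafilter 𝓕 using (upward)
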